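{- Let $\mathcal{R}$ be a commutative ring with unity and $k\in\mathbb{N}$. Let $\mathcal{I}\subsetneq\mathcal{R}$ be an ideal which satisfies the unital set condition (USC). Then the reduction map $SP_{2k}(\mathcal{R})\longrightarrow SP_{2k}(\mathcal{R}/\mathcal{I})$ is surjective.
   Context: For a commutative ring $\mathcal{S}$ with unity, $SP_{2k}(\mathcal{S})=\{A\in M_{2k\times 2k}(\mathcal{S})\mid A^tJA=J\}$ where $J=\begin{pmatrix}0_{k\times k}& I_{k\times k}\\ -I_{k\times k}&0_{k\times k}\end{pmatrix}$. A finite subset $\{a_1,\ldots,a_n\}\subseteq\mathcal{R}$ (repetitions allowed) is unital if it generates the unit ideal. An ideal $\mathcal{I}\subsetneq\mathcal{R}$ satisfies the USC if for every $n\ge 2$ and every unital set $\{a_1,\ldots,a_n\}\subseteq\mathcal{R}$ there exists $b\in\langle a_2,\ldots,a_n\rangle$ such that $a_1+b$ is a unit modulo $\mathcal{I}$. -}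

module Defs where

open import Level using (Level; _⊔_)
open import Algebra.Bundles using (CommutativeRing)
open import Data.Nat using (ℕ; zero; suc) renaming (_+_ to _+ℕ_)
open import Data.Fin using (Fin; zero; suc; splitAt)
open import Data.Fin.Properties using (_≟_)
open import Data.Sum using (inj₁; inj₂)
open import Data.Product using (Σ; _×_; ∃)
open import Relation.Nullary using (¬_; yes; no)

module _ {c ℓ : Level} (R : CommutativeRing c ℓ) where
  open CommutativeRing R using (Carrier; _≈_; _+_; _*_; -_; _-_; 0#; 1#)

  sumF : {n : ℕ} → (Fin n → Carrier) → Carrier
  sumF {zero}  a = 0#
  sumF {suc n} a = a zero + sumF (λ i → a (suc i))

  record IsIdeal {ℓI : Level} (I : Carrier → Set ℓI) : Set (c ⊔ ℓ ⊔ ℓI) where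
    field
      ∈-resp : ∀ {x y} → x ≈ y → I x → I y
      0∈     : I 0#
      +∈     : ∀ {x y} → I x → I y → I (x + y)
      *∈     : ∀ r {x} → I x → I (r * x)

  IsProper : {ℓI : Level} → (Carrier → Set ℓI) → Set (c ⊔ ℓI)
  IsProper I = ¬ (∀ x → I x)

  _≡[_]_ : {ℓI : Level} → Carrier → (Carrier → Set ℓI) → Carrier → Set ℓI
  x ≡[ I ] y = I (x - y)

  IsUnitMod : {ℓI : Level} → (Carrier → Set ℓI) → Carrier → Set (c ⊔ ℓI)
  IsUnitMod I x = ∃ λ (y : Carrier) → (x * y) ≡[ I ] 1#

  InIdealGen : {n : ℕ} → (Fin n → Carrier) → Carrier → Set (c ⊔ ℓ)
  InIdealGen {n} a b = ∃ λ (d : Fin n → Carrier) → b ≈ sumF (λ i → d i * a i)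

  Unital : {n : ℕ} → (Fin n → Carrier) → Set (c ⊔ ℓ)
  Unital a = InIdealGen a 1#

  -- unital set condition (sets indexed by Fin n, n ≥ 2, repetitions allowed;
  -- a zero plays the role of a₁)
  USC : {ℓI : Level} → (Carrier → Set ℓI) → Set (c ⊔ ℓ ⊔ ℓI)
  USC I = ∀ (m : ℕ) (a : Fin (suc (suc m)) → Carrier) → Unital a →
            ∃ λ (b : Carrier) → InIdealGen (λ i → a (suc i)) b × IsUnitMod I (a zero + b)

  Mat : ℕ → Set c
  Mat n = Fin n → Fin n → Carrier

  _ᵗ : {n : ℕ} → Mat n → Mat n
  (A ᵗ) i j = A j i

  _⊗_ : {n : ℕ} → Mat n → Mat n → Mat n
  (A ⊗ B) i j = sumF (λ l → A i l * B l j)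

  δ : {n : ℕ} → Fin n → Fin n → Carrier
  δ p q with p ≟ q
  ... | yes _ = 1#
  ... | no  _ = 0#

  J : (k : ℕ) → Mat (k +ℕ k)
  J k i j with splitAt k i | splitAt k j
  ... | inj₁ p | inj₁ q = 0#
  ... | inj₁ p | inj₂ q = δ p q
  ... | inj₂ p | inj₁ q = - δ p q
  ... | inj₂ p | inj₂ q = 0#

  IsSymplectic : (k : ℕ) → Mat (k +ℕ k) → Set ℓ
  IsSymplectic k A = ∀ i j → (((A ᵗ) ⊗ J k) ⊗ A) i j ≈ J k i j

  -- B (a matrix of representatives) defines an element of SP_{2k}(R/I)
  IsSymplecticMod : {ℓI : Level} → (Carrier → Set ℓI) → (k : ℕ) → Mat (k +ℕ k) → Set ℓI
  IsSymplecticMod I k B = ∀ i j → (((B ᵗ) ⊗ J k) ⊗ B) i j ≡[ I ] J k i j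

  ReductionSurjective : {ℓI : Level} → (Carrier → Set ℓI) → ℕ → Set (c ⊔ ℓ ⊔ ℓI)
  ReductionSurjective I k = ∀ (B : Mat (k +ℕ k)) → IsSymplecticMod I k B →
    ∃ λ (A : Mat (k +ℕ k)) → IsSymplectic k A × (∀ i j → A i j ≡[ I ] B i j)

module Submission where

-- Modulo I, the columns of B form a symplectic basis of the hyperbolic space (R²)ᵏ. Over R/I every
-- hyperbolic pair (v, v′) is moved to the standard pair (e₀, f₀) by elementary symplectic
-- transvections: writing v = (x, y) ⊕ t and v′ = (x′, y′) ⊕ t′, ω v v′ = 1 makes the triple
-- (x, y, ω t t′) unimodular, so by the USC a transvection turns x into a unit, and a vector with unit
-- first coordinate is easily moved to e₀. The remaining pairs are then orthogonal to (e₀, f₀), and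
-- the argument recurses on k. The transvections are given by ring operations alone, so they act on
-- R as well: their inverses applied to the standard basis in R give the columns of a matrix that is
-- exactly symplectic and congruent to B modulo I.

open import Level using (Level; _⊔_)
open import Algebra.Bundles using (CommutativeRing)
open import Algebra.Structures using (IsCommutativeRing)
import Algebra.Solver.Ring.AlmostCommutativeRing as ACR
open import Data.Nat as ℕ using (ℕ; zero; suc)
import Data.Nat.Properties as ℕ
open import Data.Integer as ℤ using (ℤ; +_; -[1+_]; _⊖_; 0ℤ; 1ℤ)
import Data.Integer.Properties as ℤ
open import Data.Fin using (Fin; zero; suc; _↑ˡ_; _↑ʳ_; splitAt)
open import Data.Fin.Properties
  using (_≟_; splitAt-↑ˡ; splitAt-↑ʳ; splitAt⁻¹-↑ˡ; splitAt⁻¹-↑ʳ; join-splitAt)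
open import Data.Sum using ([_,_]′; inj₁; inj₂)
open import Data.Sum.Properties using ([,]-∘)
open import Data.Product using (_×_; _,_; proj₁; proj₂; ∃; ∃₂)
open import Data.Product.Relation.Binary.Pointwise.NonDependent using (Pointwise; ×-setoid)
open import Data.Maybe using (Maybe; just; nothing)
open import Data.Vec.Functional using (Vector; _∷_; []; head; tail)
open import Data.List as List using (List; foldl; reverse; map; _++_)
open import Data.List.Properties using (unfold-reverse; foldl-∷ʳ; foldl-++)
open import Function using (_∘_)
open import Relation.Nullary using (yes; no)
open import Relation.Binary.Core using (Rel)
open import Relation.Binary.PropositionalEquality as ≡ using (_≡_)
open import Defs

module IntegerSolver {c ℓ : Level} (R : CommutativeRing c ℓ) where
  open CommutativeRing R
  open import Algebra.Properties.Ring ring using (-‿distribʳ-*; -‿involutive; x≈z//y; -0#≈0#; -‿+-comm)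
  open import Algebra.Properties.Semiring.Mult.TCOptimised semiring using (×-homo-+; 1+×) renaming (_×_ to _×′_)
  open import Algebra.Properties.CommutativeSemigroup +-commutativeSemigroup using (x∙yz≈y∙xz)
  open import Relation.Binary.Reasoning.Setoid setoid

  ⟦_⟧ℤ : ℤ → Carrier
  ⟦ + n ⟧ℤ      = n ×′ 1#
  ⟦ -[1+ n ] ⟧ℤ = - (suc n ×′ 1#)

  ⊖-homo : ∀ m n → ⟦ m ⊖ n ⟧ℤ + n ×′ 1# ≈ m ×′ 1#
  ⊖-homo zero    zero    = +-identityʳ 0#
  ⊖-homo zero    (suc n) = -‿inverseˡ (suc n ×′ 1#)
  ⊖-homo (suc m) zero    = +-identityʳ (suc m ×′ 1#)
  ⊖-homo (suc m) (suc n) = begin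
    ⟦ suc m ⊖ suc n ⟧ℤ + suc n ×′ 1# ≡⟨ ≡.cong (λ i → ⟦ i ⟧ℤ + _) (ℤ.[1+m]⊖[1+n]≡m⊖n m n) ⟩
    ⟦ m ⊖ n ⟧ℤ + suc n ×′ 1#         ≈⟨ +-congˡ (1+× n 1#) ⟩
    ⟦ m ⊖ n ⟧ℤ + (1# + n ×′ 1#)      ≈⟨ x∙yz≈y∙xz _ 1# _ ⟩
    1# + (⟦ m ⊖ n ⟧ℤ + n ×′ 1#)      ≈⟨ +-congˡ (⊖-homo m n) ⟩
    1# + m ×′ 1#                     ≈⟨ 1+× m 1# ⟨
    suc m ×′ 1#                      ∎

  +-homo : ∀ i j → ⟦ i ℤ.+ j ⟧ℤ ≈ ⟦ i ⟧ℤ + ⟦ j ⟧ℤ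
  +-homo (+ m)    (+ n)    = ×-homo-+ 1# m n
  +-homo (+ m)    -[1+ n ] = x≈z//y _ _ _ (⊖-homo m (suc n))
  +-homo -[1+ m ] (+ n)    = trans (x≈z//y _ _ _ (⊖-homo n (suc m))) (+-comm _ _)
  +-homo -[1+ m ] -[1+ n ] = begin
    - (suc (suc (m ℕ.+ n)) ×′ 1#)     ≡⟨ ≡.cong (λ k → - (suc k ×′ 1#)) (≡.sym (ℕ.+-suc m n)) ⟩
    - ((suc m ℕ.+ suc n) ×′ 1#)       ≈⟨ -‿cong (×-homo-+ 1# (suc m) (suc n)) ⟩
    - (suc m ×′ 1# + suc n ×′ 1#)     ≈⟨ -‿+-comm _ _ ⟨
    - (suc m ×′ 1#) + - (suc n ×′ 1#) ∎

  -‿homo : ∀ i → ⟦ ℤ.- i ⟧ℤ ≈ - ⟦ i ⟧ℤ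
  -‿homo (+ zero)  = sym -0#≈0#
  -‿homo (+ suc n) = refl
  -‿homo -[1+ n ]  = sym (-‿involutive _)

  *-homo-ℕ : ∀ i n → ⟦ i ℤ.* + n ⟧ℤ ≈ ⟦ i ⟧ℤ * (n ×′ 1#)
  *-homo-ℕ i zero    = begin
    ⟦ i ℤ.* + 0 ⟧ℤ ≡⟨ ≡.cong ⟦_⟧ℤ (ℤ.*-zeroʳ i) ⟩
    0#             ≈⟨ zeroʳ _ ⟨
    ⟦ i ⟧ℤ * 0#    ∎
  *-homo-ℕ i (suc n) = begin
    ⟦ i ℤ.* + suc n ⟧ℤ               ≡⟨ ≡.cong ⟦_⟧ℤ (ℤ.*-suc i (+ n)) ⟩
    ⟦ i ℤ.+ i ℤ.* + n ⟧ℤ             ≈⟨ +-homo i (i ℤ.* + n) ⟩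
    ⟦ i ⟧ℤ + ⟦ i ℤ.* + n ⟧ℤ          ≈⟨ +-cong (sym (*-identityʳ _)) (*-homo-ℕ i n) ⟩
    ⟦ i ⟧ℤ * 1# + ⟦ i ⟧ℤ * (n ×′ 1#) ≈⟨ distribˡ _ _ _ ⟨
    ⟦ i ⟧ℤ * (1# + n ×′ 1#)          ≈⟨ *-congˡ (1+× n 1#) ⟨
    ⟦ i ⟧ℤ * (suc n ×′ 1#)           ∎

  *-homo : ∀ i j → ⟦ i ℤ.* j ⟧ℤ ≈ ⟦ i ⟧ℤ * ⟦ j ⟧ℤ
  *-homo i (+ n)    = *-homo-ℕ i n
  *-homo i -[1+ n ] = begin
    ⟦ i ℤ.* ℤ.- + suc n ⟧ℤ     ≡⟨ ≡.cong ⟦_⟧ℤ (ℤ.neg-distribʳ-* i (+ suc n)) ⟨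
    ⟦ ℤ.- (i ℤ.* + suc n) ⟧ℤ   ≈⟨ -‿homo (i ℤ.* + suc n) ⟩
    - ⟦ i ℤ.* + suc n ⟧ℤ       ≈⟨ -‿cong (*-homo-ℕ i (suc n)) ⟩
    - (⟦ i ⟧ℤ * (suc n ×′ 1#)) ≈⟨ -‿distribʳ-* _ _ ⟩
    ⟦ i ⟧ℤ * - (suc n ×′ 1#)   ∎

  homomorphism : ℤ.+-*-rawRing ACR.-Raw-AlmostCommutative⟶ ACR.fromCommutativeRing R
  homomorphism = record
    { ⟦_⟧ = ⟦_⟧ℤ ; +-homo = +-homo ; *-homo = *-homo ; -‿homo = -‿homo
    ; 0-homo = refl ; 1-homo = refl }

  coefficient≟ : ∀ i j → Maybe (⟦ i ⟧ℤ ≈ ⟦ j ⟧ℤ)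
  coefficient≟ i j with i ℤ.≟ j
  ... | yes ≡.refl = just refl
  ... | no _       = nothing

  open import Algebra.Solver.Ring ℤ.+-*-rawRing (ACR.fromCommutativeRing R) homomorphism coefficient≟ public

module Hyperbolic {c ℓ : Level} (R : CommutativeRing c ℓ) where
  open CommutativeRing R using (Carrier; _+_; _*_; -_; _-_; 0#; 1#)

  Plane : Set c
  Plane = Carrier × Carrier

  -- A vector of R²ᵏ, as its coordinates (xₚ , yₚ) in the hyperbolic basis e₀, f₀, …, eₖ₋₁, fₖ₋₁.
  Hyp : ℕ → Set c
  Hyp = Vector Plane

  det : Plane → Plane → Carrier
  det (a , b) (a′ , b′) = a * b′ - b * a′

  ω : ∀ {k} → Hyp k → Hyp k → Carrier
  ω u v = sumF R (λ p → det (u p) (v p))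

  0ₕ : ∀ {k} → Hyp k
  0ₕ _ = 0# , 0#

  _·ₚ_ : Carrier → Plane → Plane
  s ·ₚ (x , y) = s * x , s * y

  _+ₚ_ : Plane → Plane → Plane
  (x , y) +ₚ (x′ , y′) = x + x′ , y + y′

  _·_ : ∀ {k} → Carrier → Hyp k → Hyp k
  (s · w) p = s ·ₚ w p

  _⊕_ : ∀ {k} → Hyp k → Hyp k → Hyp k
  (u ⊕ v) p = u p +ₚ v p

  infixr 7 _·ₚ_ _·_
  infixl 6 _+ₚ_ _⊕_

  e f : ∀ {k} → Fin k → Hyp k
  e p q = δ R q p , 0#
  f p q = 0# , δ R q p

  δ-suc : ∀ {k} (p q : Fin k) → δ R (suc p) (suc q) ≡ δ R p q
  δ-suc p q with p ≟ q
  ... | yes _ = ≡.refl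
  ... | no  _ = ≡.refl

  x₀ y₀ : ∀ {k} → Hyp (suc k) → Carrier
  x₀ v = proj₁ (head v)
  y₀ v = proj₂ (head v)

  -- Elementary symplectic transvections: τ₁ and τ₂ act within the first hyperbolic plane,
  -- φ w and ψ w move between it and the rest along w.
  data Step : ℕ → Set c where
    τ₁ τ₂ : ∀ {k} → Carrier → Step (suc k)
    φ ψ   : ∀ {k} → Hyp k → Step (suc k)
    lift  : ∀ {k} → Step k → Step (suc k)

  apply : ∀ {k} → Step k → Hyp k → Hyp k
  apply (τ₁ r)   v = (x₀ v + r * y₀ v , y₀ v) ∷ tail v
  apply (τ₂ r)   v = (x₀ v , y₀ v + r * x₀ v) ∷ tail v
  apply (φ w)    v = (x₀ v + ω w (tail v) , y₀ v) ∷ (tail v ⊕ y₀ v · w)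
  apply (ψ w)    v = (x₀ v , y₀ v + ω w (tail v)) ∷ (tail v ⊕ (- x₀ v) · w)
  apply (lift s) v = head v ∷ apply s (tail v)

  inverse : ∀ {k} → Step k → Step k
  inverse (τ₁ r)   = τ₁ (- r)
  inverse (τ₂ r)   = τ₂ (- r)
  inverse (φ w)    = φ ((- 1#) · w)
  inverse (ψ w)    = ψ ((- 1#) · w)
  inverse (lift s) = lift (inverse s)

  apply* : ∀ {k} → List (Step k) → Hyp k → Hyp k
  apply* L v = foldl (λ u s → apply s u) v L

  inverse* : ∀ {k} → List (Step k) → List (Step k)
  inverse* L = reverse (map inverse L)

  apply*-++ : ∀ {k} (L M : List (Step k)) v → apply* (L ++ M) v ≡ apply* M (apply* L v)
  apply*-++ L M v = foldl-++ (λ u s → apply s u) v L M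

  -- As in J, rows p and k + p of a 2k × 2k matrix hold the coordinates xₚ and yₚ.
  column : ∀ {k} → Mat R (k ℕ.+ k) → Fin (k ℕ.+ k) → Hyp k
  column {k} M j q = M (q ↑ˡ k) j , M (k ↑ʳ q) j

  entry : ∀ {k} → Hyp k → Fin (k ℕ.+ k) → Carrier
  entry {k} v i = [ proj₁ ∘ v , proj₂ ∘ v ]′ (splitAt k i)

  basis : ∀ {k} → Fin (k ℕ.+ k) → Hyp k
  basis {k} j = [ e , f ]′ (splitAt k j)

  J-↑ˡ-↑ˡ : ∀ k (p q : Fin k) → J R k (p ↑ˡ k) (q ↑ˡ k) ≡ 0#
  J-↑ˡ-↑ˡ k p q rewrite splitAt-↑ˡ k p k | splitAt-↑ˡ k q k = ≡.refl

  J-↑ˡ-↑ʳ : ∀ k (p q : Fin k) → J R k (p ↑ˡ k) (k ↑ʳ q) ≡ δ R p q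
  J-↑ˡ-↑ʳ k p q rewrite splitAt-↑ˡ k p k | splitAt-↑ʳ k k q = ≡.refl

  J-↑ʳ-↑ˡ : ∀ k (p q : Fin k) → J R k (k ↑ʳ p) (q ↑ˡ k) ≡ - δ R p q
  J-↑ʳ-↑ˡ k p q rewrite splitAt-↑ʳ k k p | splitAt-↑ˡ k q k = ≡.refl

  J-↑ʳ-↑ʳ : ∀ k (p q : Fin k) → J R k (k ↑ʳ p) (k ↑ʳ q) ≡ 0#
  J-↑ʳ-↑ʳ k p q rewrite splitAt-↑ʳ k k p | splitAt-↑ʳ k k q = ≡.refl

  entry-column : ∀ {k} (M : Mat R (k ℕ.+ k)) i j → entry (column {k} M j) i ≡ M i j
  entry-column {k} M i j =
    ≡.trans (≡.sym ([,]-∘ (λ l → M l j) (splitAt k i))) (≡.cong (λ l → M l j) (join-splitAt k k i))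

  column-entry : ∀ {k} (v : Hyp k) q → (entry v (q ↑ˡ k) , entry v (k ↑ʳ q)) ≡ v q
  column-entry {k} v q rewrite splitAt-↑ˡ k q k | splitAt-↑ʳ k k q = ≡.refl

  -- Everything below holds for any commutative ring structure on the operations of R;
  -- it is used both for R itself and for R modulo an ideal.
  module Laws {ℓ′ : Level} {_∼_ : Rel Carrier ℓ′} (isCR : IsCommutativeRing _∼_ _+_ _*_ -_ 0# 1#) where
    ring′ : CommutativeRing c ℓ′
    ring′ = record { isCommutativeRing = isCR }
    open CommutativeRing ring′
      using (_≈_; refl; sym; trans; reflexive; setoid; +-cong; +-congˡ; +-congʳ; *-cong; *-congˡ; *-congʳ; -‿cong;
             +-identityˡ; +-identityʳ; +-assoc; *-identityʳ; zeroʳ; distribˡ)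
    open import Algebra.Properties.Ring (CommutativeRing.ring ring′)
      using (-‿involutive; -0#≈0#; -‿+-comm; -‿distribʳ-*; //-rightDividesʳ)
    open IntegerSolver ring′ using (solve; _:=_; _:+_; _:*_; :-_; _:-_; con)
    open import Relation.Binary.Reasoning.Setoid setoid
    open import Data.Vec.Functional.Relation.Binary.Equality.Setoid (×-setoid setoid setoid)
      public using (_≋_; ≋-refl; ≋-sym; ≋-trans; ≋-reflexive)

    infix 4 _≈ₚ_
    _≈ₚ_ : Plane → Plane → Set ℓ′
    _≈ₚ_ = Pointwise _≈_ _≈_

    sumF-cong : ∀ {n} {a b : Fin n → Carrier} → (∀ p → a p ≈ b p) → sumF R a ≈ sumF R b
    sumF-cong {zero}  a≈b = refl
    sumF-cong {suc n} a≈b = +-cong (a≈b zero) (sumF-cong (a≈b ∘ suc))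

    sumF-zero : ∀ {n} {a : Fin n → Carrier} → (∀ p → a p ≈ 0#) → sumF R a ≈ 0#
    sumF-zero {zero}  a≈0 = refl
    sumF-zero {suc n} a≈0 = trans (+-cong (a≈0 zero) (sumF-zero (a≈0 ∘ suc))) (+-identityʳ 0#)

    sumF-+ : ∀ {n} (a b : Fin n → Carrier) → sumF R (λ p → a p + b p) ≈ sumF R a + sumF R b
    sumF-+ {zero}  a b = sym (+-identityʳ 0#)
    sumF-+ {suc n} a b = trans (+-congˡ (sumF-+ (a ∘ suc) (b ∘ suc)))
      (solve 4 (λ x y s t → (x :+ y) :+ (s :+ t) := (x :+ s) :+ (y :+ t)) refl _ _ _ _)

    sumF-* : ∀ {n} r (a : Fin n → Carrier) → sumF R (λ p → r * a p) ≈ r * sumF R a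
    sumF-* {zero}  r a = sym (zeroʳ r)
    sumF-* {suc n} r a = trans (+-congˡ (sumF-* r (a ∘ suc))) (sym (distribˡ r _ _))

    sumF-neg : ∀ {n} (a : Fin n → Carrier) → sumF R (λ p → - a p) ≈ - sumF R a
    sumF-neg {zero}  a = sym -0#≈0#
    sumF-neg {suc n} a = trans (+-congˡ (sumF-neg (a ∘ suc))) (-‿+-comm _ _)

    sumF-δ : ∀ {n} (a : Fin n → Carrier) p → sumF R (λ q → a q * δ R q p) ≈ a p
    sumF-δ {suc n} a zero    = begin
      a zero * 1# + sumF R (λ q → a (suc q) * 0#) ≈⟨ +-cong (*-identityʳ _) (sumF-zero (zeroʳ ∘ a ∘ suc)) ⟩
      a zero + 0#                                 ≈⟨ +-identityʳ _ ⟩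
      a zero                                      ∎
    sumF-δ {suc n} a (suc p) = begin
      a zero * 0# + sumF R (λ q → a (suc q) * δ R (suc q) (suc p))
        ≈⟨ +-cong (zeroʳ _) (sumF-cong λ q → *-congˡ (reflexive (δ-suc q p))) ⟩
      0# + sumF R (λ q → a (suc q) * δ R q p)
        ≈⟨ trans (+-identityˡ _) (sumF-δ (a ∘ suc) p) ⟩
      a (suc p) ∎

    sumF-split : ∀ m n (a : Fin (m ℕ.+ n) → Carrier) →
                 sumF R a ≈ sumF R (λ p → a (p ↑ˡ n)) + sumF R (λ p → a (m ↑ʳ p))
    sumF-split zero    n a = sym (+-identityˡ _)
    sumF-split (suc m) n a = trans (+-congˡ (sumF-split m n (a ∘ suc))) (sym (+-assoc _ _ _))

    det-cong : ∀ {a a′ b b′} → a ≈ₚ a′ → b ≈ₚ b′ → det a b ≈ det a′ b′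
    det-cong (x≈ , y≈) (x′≈ , y′≈) = +-cong (*-cong x≈ y′≈) (-‿cong (*-cong y≈ x′≈))

    det-antisym : ∀ a b → det a b ≈ - det b a
    det-antisym (x , y) (x′ , y′) =
      solve 4 (λ x y x′ y′ → x :* y′ :- y :* x′ := :- (x′ :* y :- y′ :* x)) refl x y x′ y′

    det-alternating : ∀ a → det a a ≈ 0#
    det-alternating (x , y) = solve 2 (λ x y → x :* y :- y :* x := con 0ℤ) refl x y

    det-zeroˡ : ∀ a → det (0# , 0#) a ≈ 0#
    det-zeroˡ (x , y) = solve 2 (λ x y → con 0ℤ :* y :- con 0ℤ :* x := con 0ℤ) refl x y

    det-zeroʳ : ∀ a → det a (0# , 0#) ≈ 0#
    det-zeroʳ a = trans (det-antisym a _) (trans (-‿cong (det-zeroˡ a)) -0#≈0#)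

    det-·ˡ : ∀ s a b → det (s ·ₚ a) b ≈ s * det a b
    det-·ˡ s (x , y) (x′ , y′) =
      solve 5 (λ s x y x′ y′ → s :* x :* y′ :- s :* y :* x′ := s :* (x :* y′ :- y :* x′)) refl s x y x′ y′

    det-+·ʳ : ∀ a t w s → det a (t +ₚ s ·ₚ w) ≈ det a t + s * det a w
    det-+·ʳ (x , y) (a , b) (c , d) s =
      solve 7 (λ x y a b c d s → x :* (b :+ s :* d) :- y :* (a :+ s :* c)
                                 := (x :* b :- y :* a) :+ s :* (x :* d :- y :* c))
        refl x y a b c d s

    det-shear : ∀ t t′ w s s′ →
                det (t +ₚ s ·ₚ w) (t′ +ₚ s′ ·ₚ w) ≈ det t t′ + (s * det w t′ + - (s′ * det w t))
    det-shear (a , b) (a′ , b′) (x , y) s s′ =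
      solve 8 (λ a b a′ b′ x y s s′ →
          (a :+ s :* x) :* (b′ :+ s′ :* y) :- (b :+ s :* y) :* (a′ :+ s′ :* x)
          := (a :* b′ :- b :* a′) :+ (s :* (x :* b′ :- y :* a′) :+ :- (s′ :* (x :* b :- y :* a))))
        refl a b a′ b′ x y s s′

    ω-cong : ∀ {k} {u u′ v v′ : Hyp k} → u ≋ u′ → v ≋ v′ → ω u v ≈ ω u′ v′
    ω-cong u≋u′ v≋v′ = sumF-cong λ p → det-cong (u≋u′ p) (v≋v′ p)

    ω-congˡ : ∀ {k} {u u′ : Hyp k} v → u ≋ u′ → ω u v ≈ ω u′ v
    ω-congˡ v u≋u′ = ω-cong u≋u′ (≋-refl {x = v})

    ω-antisym : ∀ {k} (u v : Hyp k) → ω u v ≈ - ω v u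
    ω-antisym {k} u v = trans (sumF-cong λ p → det-antisym (u p) (v p)) (sumF-neg {k} _)

    ω-alternating : ∀ {k} (u : Hyp k) → ω u u ≈ 0#
    ω-alternating u = sumF-zero (det-alternating ∘ u)

    ω-zeroˡ : ∀ {k} (u : Hyp k) → ω 0ₕ u ≈ 0#
    ω-zeroˡ u = sumF-zero (det-zeroˡ ∘ u)

    ω-zeroʳ : ∀ {k} (u : Hyp k) → ω u 0ₕ ≈ 0#
    ω-zeroʳ u = sumF-zero (det-zeroʳ ∘ u)

    ω-·ˡ : ∀ {k} s (u v : Hyp k) → ω (s · u) v ≈ s * ω u v
    ω-·ˡ {k} s u v = trans (sumF-cong λ p → det-·ˡ s (u p) (v p)) (sumF-* {k} s _)

    ω-⊕·ʳ : ∀ {k} (u t w : Hyp k) s → ω u (t ⊕ s · w) ≈ ω u t + s * ω u w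
    ω-⊕·ʳ {k} u t w s =
      trans (sumF-cong λ p → det-+·ʳ (u p) (t p) (w p) s) (trans (sumF-+ {k} _ _) (+-congˡ (sumF-* {k} s _)))

    -- No ω w w term survives since ω is alternating.
    ω-shear : ∀ {k} (t t′ w : Hyp k) s s′ →
              ω (t ⊕ s · w) (t′ ⊕ s′ · w) ≈ ω t t′ + (s * ω w t′ - s′ * ω w t)
    ω-shear {k} t t′ w s s′ = begin
      ω (t ⊕ s · w) (t′ ⊕ s′ · w)
        ≈⟨ sumF-cong (λ p → det-shear (t p) (t′ p) (w p) s s′) ⟩
      sumF R (λ p → det (t p) (t′ p) + (s * det (w p) (t′ p) + - (s′ * det (w p) (t p))))
        ≈⟨ sumF-+ {k} _ _ ⟩
      ω t t′ + sumF R (λ p → s * det (w p) (t′ p) + - (s′ * det (w p) (t p)))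
        ≈⟨ +-congˡ (trans (sumF-+ {k} _ _)
                          (+-cong (sumF-* {k} s _) (trans (sumF-neg {k} _) (-‿cong (sumF-* {k} s′ _))))) ⟩
      ω t t′ + (s * ω w t′ - s′ * ω w t) ∎

    ω-unshear : ∀ {k} (w t : Hyp k) s → ω ((- 1#) · w) (t ⊕ s · w) ≈ - ω w t
    ω-unshear w t s = begin
      ω ((- 1#) · w) (t ⊕ s · w)  ≈⟨ ω-·ˡ (- 1#) w _ ⟩
      - 1# * ω w (t ⊕ s · w)      ≈⟨ *-congˡ (trans (ω-⊕·ʳ w t w s) (+-congˡ (*-congˡ (ω-alternating w)))) ⟩
      - 1# * (ω w t + s * 0#)
        ≈⟨ solve 2 (λ a s → :- con 1ℤ :* (a :+ s :* con 0ℤ) := :- a) refl (ω w t) s ⟩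
      - ω w t                     ∎

    ⊕·-cong : ∀ {k} {t t′ : Hyp k} {s s′} (w : Hyp k) → t ≋ t′ → s ≈ s′ → t ⊕ s · w ≋ t′ ⊕ s′ · w
    ⊕·-cong w t≋t′ s≈s′ p = +-cong (proj₁ (t≋t′ p)) (*-congʳ s≈s′)
                          , +-cong (proj₂ (t≋t′ p)) (*-congʳ s≈s′)

    ⊕·-unshear : ∀ {k} (t : Hyp k) s w → (t ⊕ s · w) ⊕ s · (- 1#) · w ≋ t
    ⊕·-unshear t s w p = unshear (proj₁ (t p)) (proj₁ (w p)) , unshear (proj₂ (t p)) (proj₂ (w p))
      where
      unshear : ∀ a z → (a + s * z) + s * (- 1# * z) ≈ a
      unshear a z = solve 3 (λ a z s → (a :+ s :* z) :+ s :* (:- con 1ℤ :* z) := a) refl a z s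

    ⊕0·-identity : ∀ {k} (t w : Hyp k) {s} → s ≈ 0# → t ⊕ s · w ≋ t
    ⊕0·-identity t w s≈0 p = vanish (proj₁ (t p)) (proj₁ (w p)) , vanish (proj₂ (t p)) (proj₂ (w p))
      where
      vanish : ∀ a z → a + _ * z ≈ a
      vanish a z = trans (+-congˡ (*-congʳ s≈0)) (solve 2 (λ a z → a :+ con 0ℤ :* z := a) refl a z)

    x₀≈ : ∀ {k} {u v : Hyp (suc k)} → u ≋ v → x₀ u ≈ x₀ v
    x₀≈ u≋v = proj₁ (u≋v zero)

    y₀≈ : ∀ {k} {u v : Hyp (suc k)} → u ≋ v → y₀ u ≈ y₀ v
    y₀≈ u≋v = proj₂ (u≋v zero)

    apply-cong : ∀ {k} (s : Step k) {u v : Hyp k} → u ≋ v → apply s u ≋ apply s v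
    apply-cong (τ₁ r)   u≋v zero    = +-cong (x₀≈ u≋v) (*-congˡ (y₀≈ u≋v)) , y₀≈ u≋v
    apply-cong (τ₂ r)   u≋v zero    = x₀≈ u≋v , +-cong (y₀≈ u≋v) (*-congˡ (x₀≈ u≋v))
    apply-cong (φ w)    u≋v zero    = +-cong (x₀≈ u≋v) (ω-cong ≋-refl (u≋v ∘ suc)) , y₀≈ u≋v
    apply-cong (ψ w)    u≋v zero    = x₀≈ u≋v , +-cong (y₀≈ u≋v) (ω-cong ≋-refl (u≋v ∘ suc))
    apply-cong (lift s) u≋v zero    = u≋v zero
    apply-cong (τ₁ r)   u≋v (suc p) = u≋v (suc p)
    apply-cong (τ₂ r)   u≋v (suc p) = u≋v (suc p)
    apply-cong (φ w)    u≋v (suc p) = ⊕·-cong w (u≋v ∘ suc) (y₀≈ u≋v) p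
    apply-cong (ψ w)    u≋v (suc p) = ⊕·-cong w (u≋v ∘ suc) (-‿cong (x₀≈ u≋v)) p
    apply-cong (lift s) u≋v (suc p) = apply-cong s (u≋v ∘ suc) p

    apply-ω : ∀ {k} (s : Step k) (u v : Hyp k) → ω (apply s u) (apply s v) ≈ ω u v
    apply-ω (τ₁ r) u v = +-congʳ
      (solve 5 (λ x y x′ y′ r → (x :+ r :* y) :* y′ :- y :* (x′ :+ r :* y′) := x :* y′ :- y :* x′) refl
         (x₀ u) (y₀ u) (x₀ v) (y₀ v) r)
    apply-ω (τ₂ r) u v = +-congʳ
      (solve 5 (λ x y x′ y′ r → x :* (y′ :+ r :* x′) :- (y :+ r :* x) :* x′ := x :* y′ :- y :* x′) refl
         (x₀ u) (y₀ u) (x₀ v) (y₀ v) r)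
    apply-ω (φ w) u v = trans (+-congˡ (ω-shear (tail u) (tail v) w (y₀ u) (y₀ v)))
      (solve 7 (λ x y x′ y′ a b c → ((x :+ a) :* y′ :- y :* (x′ :+ b)) :+ (c :+ (y :* b :- y′ :* a))
                                    := (x :* y′ :- y :* x′) :+ c) refl
         (x₀ u) (y₀ u) (x₀ v) (y₀ v) (ω w (tail u)) (ω w (tail v)) (ω (tail u) (tail v)))
    apply-ω (ψ w) u v = trans (+-congˡ (ω-shear (tail u) (tail v) w (- x₀ u) (- x₀ v)))
      (solve 7 (λ x y x′ y′ a b c → (x :* (y′ :+ b) :- (y :+ a) :* x′) :+ (c :+ (:- x :* b :- :- x′ :* a))
                                    := (x :* y′ :- y :* x′) :+ c) refl
         (x₀ u) (y₀ u) (x₀ v) (y₀ v) (ω w (tail u)) (ω w (tail v)) (ω (tail u) (tail v)))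
    apply-ω (lift s) u v = +-congˡ (apply-ω s (tail u) (tail v))

    apply-inverse : ∀ {k} (s : Step k) (v : Hyp k) → apply (inverse s) (apply s v) ≋ v
    apply-inverse (τ₁ r)   v zero    = solve 3 (λ x y r → (x :+ r :* y) :+ :- r :* y := x) refl (x₀ v) (y₀ v) r , refl
    apply-inverse (τ₂ r)   v zero    = refl , solve 3 (λ x y r → (y :+ r :* x) :+ :- r :* x := y) refl (x₀ v) (y₀ v) r
    apply-inverse (φ w)    v zero    =
      trans (+-congˡ (ω-unshear w (tail v) (y₀ v))) (//-rightDividesʳ (ω w (tail v)) (x₀ v)) , refl
    apply-inverse (ψ w)    v zero    =
      refl , trans (+-congˡ (ω-unshear w (tail v) (- x₀ v))) (//-rightDividesʳ (ω w (tail v)) (y₀ v))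
    apply-inverse (lift s) v zero    = refl , refl
    apply-inverse (τ₁ r)   v (suc p) = refl , refl
    apply-inverse (τ₂ r)   v (suc p) = refl , refl
    apply-inverse (φ w)    v (suc p) = ⊕·-unshear (tail v) (y₀ v) w p
    apply-inverse (ψ w)    v (suc p) = ⊕·-unshear (tail v) (- x₀ v) w p
    apply-inverse (lift s) v (suc p) = apply-inverse s (tail v) p

    apply-zero : ∀ {k} (s : Step k) → apply s 0ₕ ≋ 0ₕ
    apply-zero (τ₁ r)   zero    = solve 1 (λ r → con 0ℤ :+ r :* con 0ℤ := con 0ℤ) refl r , refl
    apply-zero (τ₂ r)   zero    = refl , solve 1 (λ r → con 0ℤ :+ r :* con 0ℤ := con 0ℤ) refl r
    apply-zero (φ w)    zero    = trans (+-congˡ (ω-zeroʳ w)) (solve 0 (con 0ℤ :+ con 0ℤ := con 0ℤ) refl) , refl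
    apply-zero (ψ w)    zero    = refl , trans (+-congˡ (ω-zeroʳ w)) (solve 0 (con 0ℤ :+ con 0ℤ := con 0ℤ) refl)
    apply-zero (lift s) zero    = refl , refl
    apply-zero (τ₁ r)   (suc p) = refl , refl
    apply-zero (τ₂ r)   (suc p) = refl , refl
    apply-zero (φ w)    (suc p) = ⊕0·-identity 0ₕ w refl p
    apply-zero (ψ w)    (suc p) = ⊕0·-identity 0ₕ w (solve 0 (:- con 0ℤ := con 0ℤ) refl) p
    apply-zero (lift s) (suc p) = apply-zero s p

    apply*-cong : ∀ {k} (L : List (Step k)) {u v : Hyp k} → u ≋ v → apply* L u ≋ apply* L v
    apply*-cong List.[]     u≋v = u≋v
    apply*-cong (s List.∷ L) u≋v = apply*-cong L (apply-cong s u≋v)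

    apply*-ω : ∀ {k} (L : List (Step k)) (u v : Hyp k) → ω (apply* L u) (apply* L v) ≈ ω u v
    apply*-ω List.[]     u v = refl
    apply*-ω (s List.∷ L) u v = trans (apply*-ω L (apply s u) (apply s v)) (apply-ω s u v)

    apply*-zero : ∀ {k} (L : List (Step k)) → apply* L 0ₕ ≋ 0ₕ
    apply*-zero List.[]     = ≋-refl
    apply*-zero (s List.∷ L) = ≋-trans (apply*-cong L (apply-zero s)) (apply*-zero L)

    apply*-inverse : ∀ {k} (L : List (Step k)) (v : Hyp k) → apply* (inverse* L) (apply* L v) ≋ v
    apply*-inverse List.[]     v = ≋-refl
    apply*-inverse (s List.∷ L) v
      rewrite unfold-reverse (inverse s) (map inverse L)
            | foldl-∷ʳ (λ u s → apply s u) (apply* L (apply s v)) (inverse s) (inverse* L)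
            = ≋-trans (apply-cong (inverse s) (apply*-inverse L (apply s v))) (apply-inverse s v)

    ω-e₀ : ∀ {k} (u : Hyp (suc k)) → ω (e zero) u ≈ y₀ u
    ω-e₀ u = trans (+-congˡ (ω-zeroˡ (tail u)))
                   (solve 2 (λ x y → (con 1ℤ :* y :- con 0ℤ :* x) :+ con 0ℤ := y) refl (x₀ u) (y₀ u))

    ω-f₀ : ∀ {k} (u : Hyp (suc k)) → ω (f zero) u ≈ - x₀ u
    ω-f₀ u = trans (+-congˡ (ω-zeroˡ (tail u)))
                   (solve 2 (λ x y → (con 0ℤ :* y :- con 1ℤ :* x) :+ con 0ℤ := :- x) refl (x₀ u) (y₀ u))

    IsUnit : Carrier → Set (c ⊔ ℓ′)
    IsUnit x = ∃ λ y → x * y ≈ 1#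

    -- The unital set condition of the zero ideal, for sets of size three.
    USC₃ : Set (c ⊔ ℓ′)
    USC₃ = ∀ x y s α β γ → x * α + y * β + s * γ ≈ 1# → ∃₂ λ r r′ → IsUnit (x + r * y + r′ * s)

    make-x₀-unit : USC₃ → ∀ {k} (v v′ : Hyp (suc k)) → ω v v′ ≈ 1# →
                   ∃ λ L → IsUnit (x₀ (apply* L v))
    make-x₀-unit usc v v′ ω≈1 =
      let r , r′ , z , unit = usc x y (ω t t′) y′ (- x′) 1# unimodular in
      τ₁ r List.∷ φ ((- r′) · t′) List.∷ List.[] , z , trans (*-congʳ (shifted r r′)) unit
      where
      x = x₀ v; y = y₀ v; t = tail v; x′ = x₀ v′; y′ = y₀ v′; t′ = tail v′
      unimodular : x * y′ + y * - x′ + ω t t′ * 1# ≈ 1#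
      unimodular = trans (solve 5 (λ x y x′ y′ c → x :* y′ :+ y :* :- x′ :+ c :* con 1ℤ := (x :* y′ :- y :* x′) :+ c)
                                  refl x y x′ y′ (ω t t′))
                         ω≈1
      shifted : ∀ r r′ → (x + r * y) + ω ((- r′) · t′) t ≈ x + r * y + r′ * ω t t′
      shifted r r′ = begin
        (x + r * y) + ω ((- r′) · t′) t
          ≈⟨ +-congˡ (trans (ω-·ˡ (- r′) t′ t) (*-congˡ (ω-antisym t′ t))) ⟩
        (x + r * y) + - r′ * - ω t t′
          ≈⟨ solve 3 (λ a r′ c → a :+ :- r′ :* :- c := a :+ r′ :* c) refl (x + r * y) r′ (ω t t′) ⟩
        x + r * y + r′ * ω t t′ ∎

    -- Once x₀ is a unit u with inverse z, ψ (z · t) clears the tail and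
    -- (u, _) ↦ (u, 1 - u) ↦ (1, 1 - u) ↦ (1, 0) is done by τ₂, τ₁, τ₂.
    x₀-unit⇒e₀ : ∀ {k} (v : Hyp (suc k)) → IsUnit (x₀ v) → ∃ λ L → apply* L v ≋ e zero
    x₀-unit⇒e₀ v (z , uz≈1) = L , reduced
      where
      u = x₀ v; t = tail v
      y₁ = y₀ v + ω (z · t) t
      r  = z * ((1# - u) - y₁)
      y₂ = y₁ + r * u
      L = ψ (z · t) List.∷ τ₂ r List.∷ τ₁ 1# List.∷ τ₂ (- y₂) List.∷ List.[]
      y₂≈1-u : y₂ ≈ 1# - u
      y₂≈1-u = begin
        y₁ + z * ((1# - u) - y₁) * u
          ≈⟨ solve 3 (λ y₁ z u → y₁ :+ z :* ((con 1ℤ :- u) :- y₁) :* u := y₁ :+ ((con 1ℤ :- u) :- y₁) :* (u :* z))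
                     refl y₁ z u ⟩
        y₁ + ((1# - u) - y₁) * (u * z)
          ≈⟨ +-congˡ (*-congˡ uz≈1) ⟩
        y₁ + ((1# - u) - y₁) * 1#
          ≈⟨ solve 2 (λ y₁ u → y₁ :+ ((con 1ℤ :- u) :- y₁) :* con 1ℤ := con 1ℤ :- u) refl y₁ u ⟩
        1# - u ∎
      x₃≈1 : u + 1# * y₂ ≈ 1#
      x₃≈1 = trans (+-congˡ (*-congˡ y₂≈1-u))
                   (solve 1 (λ u → u :+ con 1ℤ :* (con 1ℤ :- u) := con 1ℤ) refl u)
      cleared : ∀ a → a + (- u) * (z * a) ≈ 0#
      cleared a = begin
        a + (- u) * (z * a) ≈⟨ solve 3 (λ a u z → a :+ (:- u) :* (z :* a) := a :+ :- ((u :* z) :* a)) refl a u z ⟩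
        a + - ((u * z) * a) ≈⟨ +-congˡ (-‿cong (*-congʳ uz≈1)) ⟩
        a + - (1# * a)      ≈⟨ solve 1 (λ a → a :+ :- (con 1ℤ :* a) := con 0ℤ) refl a ⟩
        0#                  ∎
      reduced : apply* L v ≋ e zero
      reduced zero    = x₃≈1 , trans (+-congˡ (*-congˡ x₃≈1))
                                     (solve 1 (λ a → a :+ (:- a) :* con 1ℤ := con 0ℤ) refl y₂)
      reduced (suc p) = cleared (proj₁ (t p)) , cleared (proj₂ (t p))

    e₀-partner⇒f₀ : ∀ {k} (v v′ : Hyp (suc k)) → v ≋ e zero → ω v v′ ≈ 1# →
                    ∃ λ L → apply* L v ≋ e zero × apply* L v′ ≋ f zero
    e₀-partner⇒f₀ v v′ v≋e₀ ω≈1 = L , ≋-trans (apply*-cong L v≋e₀) e₀-fixed , v′-reduced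
      where
      x′ = x₀ v′; y′ = y₀ v′; t′ = tail v′
      w  = (- 1#) · t′
      x₁ = x′ + ω w t′
      L = φ w List.∷ τ₁ (- x₁) List.∷ List.[]
      y′≈1 : y′ ≈ 1#
      y′≈1 = trans (sym (ω-e₀ v′)) (trans (ω-congˡ v′ (≋-sym v≋e₀)) ω≈1)
      e₀-fixed : apply* L (e zero) ≋ e zero
      e₀-fixed zero    = trans (+-congʳ (+-congˡ (ω-zeroʳ w)))
                               (solve 1 (λ r → (con 1ℤ :+ con 0ℤ) :+ r :* con 0ℤ := con 1ℤ) refl (- x₁))
                       , refl
      e₀-fixed (suc p) = ⊕0·-identity 0ₕ w refl p
      v′-reduced : apply* L v′ ≋ f zero
      v′-reduced zero    = trans (+-congˡ (*-congˡ y′≈1)) (solve 1 (λ a → a :+ :- a :* con 1ℤ := con 0ℤ) refl x₁)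
                         , y′≈1
      v′-reduced (suc p) = cancelled (proj₁ (t′ p)) , cancelled (proj₂ (t′ p))
        where
        cancelled : ∀ a → a + y′ * (- 1# * a) ≈ 0#
        cancelled a = trans (+-congˡ (*-congʳ y′≈1))
                            (solve 1 (λ a → a :+ con 1ℤ :* (:- con 1ℤ :* a) := con 0ℤ) refl a)

    -- Opaque because only its type is ever needed, and unfolding its proof term makes the
    -- type checking of reduce-basis blow up.
    opaque
      reduce-pair : USC₃ → ∀ {k} (v v′ : Hyp (suc k)) → ω v v′ ≈ 1# →
                    ∃ λ L → apply* L v ≋ e zero × apply* L v′ ≋ f zero
      reduce-pair usc v v′ ω≈1 =
        let L₁ , unit          = make-x₀-unit usc v v′ ω≈1
            L₂ , v↦e₀          = x₀-unit⇒e₀ (apply* L₁ v) unit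
            L₃ , e₀↦e₀ , v′↦f₀ =
              e₀-partner⇒f₀ (apply* L₂ (apply* L₁ v)) (apply* L₂ (apply* L₁ v′)) v↦e₀
                (trans (apply*-ω L₂ (apply* L₁ v) (apply* L₁ v′)) (trans (apply*-ω L₁ v v′) ω≈1))
            composite : ∀ w → apply* (L₁ ++ L₂ ++ L₃) w ≡ apply* L₃ (apply* L₂ (apply* L₁ w))
            composite w = ≡.trans (apply*-++ L₁ (L₂ ++ L₃) w) (apply*-++ L₂ L₃ (apply* L₁ w))
        in L₁ ++ L₂ ++ L₃
         , ≋-trans (≋-reflexive (composite v)) e₀↦e₀
         , ≋-trans (≋-reflexive (composite v′)) v′↦f₀

    IsSymplecticBasis : ∀ {k} → (Fin k → Hyp k) → (Fin k → Hyp k) → Set ℓ′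
    IsSymplecticBasis u v = ∀ p q → ω (u p) (u q) ≈ 0# × ω (v p) (v q) ≈ 0# × ω (u p) (v q) ≈ δ R p q

    ω-tail : ∀ {k} (u v : Hyp (suc k)) → head u ≈ₚ (0# , 0#) → ω u v ≈ ω (tail u) (tail v)
    ω-tail u v (x≈0 , y≈0) =
      trans (+-congʳ (+-cong (*-congʳ x≈0) (-‿cong (*-congʳ y≈0))))
            (solve 3 (λ a b c → (con 0ℤ :* a :- con 0ℤ :* b) :+ c := c) refl (y₀ v) (x₀ v) (ω (tail u) (tail v)))

    orthogonal⇒head-zero : ∀ {k} (L : List (Step (suc k))) {u v w : Hyp (suc k)} →
                        apply* L u ≋ e zero → apply* L v ≋ f zero → ω u w ≈ 0# → ω v w ≈ 0# →
                        head (apply* L w) ≈ₚ (0# , 0#)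
    orthogonal⇒head-zero L {u} {v} {w} u↦e₀ v↦f₀ u⊥w v⊥w = x≈0 , y≈0
      where
      transported : ∀ {a} b → apply* L a ≋ b → ω a w ≈ 0# → ω b (apply* L w) ≈ 0#
      transported {a} b a↦b a⊥w = trans (ω-congˡ (apply* L w) (≋-sym a↦b)) (trans (apply*-ω L a w) a⊥w)
      y≈0 = trans (sym (ω-e₀ (apply* L w))) (transported (e zero) u↦e₀ u⊥w)
      -x≈0 = trans (sym (ω-f₀ (apply* L w))) (transported (f zero) v↦f₀ v⊥w)
      x≈0 = trans (sym (-‿involutive _)) (trans (-‿cong -x≈0) -0#≈0#)

    apply*-lift : ∀ {k} (L : List (Step k)) v → apply* (map lift L) v ≋ head v ∷ apply* L (tail v)
    apply*-lift List.[]     v zero    = refl , refl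
    apply*-lift List.[]     v (suc p) = refl , refl
    apply*-lift (s List.∷ L) v         = apply*-lift L (apply (lift s) v)

    apply*-extend : ∀ {k} (L₁ : List (Step (suc k))) (L₂ : List (Step k)) {w target : Hyp (suc k)} →
                    head (apply* L₁ w) ≈ₚ head target → apply* L₂ (tail (apply* L₁ w)) ≋ tail target →
                    apply* (L₁ ++ map lift L₂) w ≋ target
    apply*-extend L₁ L₂ {w} head≈ tail≋ =
      ≋-trans (≋-reflexive (apply*-++ L₁ (map lift L₂) w))
        (≋-trans (apply*-lift L₂ (apply* L₁ w)) λ { zero → head≈ ; (suc p) → tail≋ p })

    e-suc : ∀ {k} (p : Fin k) → e p ≋ tail (e (suc p))
    e-suc p q = reflexive (≡.sym (δ-suc q p)) , refl

    f-suc : ∀ {k} (p : Fin k) → f p ≋ tail (f (suc p))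
    f-suc p q = refl , reflexive (≡.sym (δ-suc q p))

    reduce-basis : USC₃ → ∀ {k} (u v : Fin k → Hyp k) → IsSymplecticBasis u v →
                   ∃ λ L → ∀ p → apply* L (u p) ≋ e p × apply* L (v p) ≋ f p
    reduce-basis usc {zero}  u v basis = List.[] , λ ()
    reduce-basis usc {suc k} u v basis with reduce-pair usc (u zero) (v zero) (proj₂ (proj₂ (basis zero zero)))
    ... | L₁ , u₀↦e₀ , v₀↦f₀ = L₁ ++ map lift L₂ , reduced
      where
      head-0 : ∀ {w} → ω (u zero) w ≈ 0# → ω (v zero) w ≈ 0# → head (apply* L₁ w) ≈ₚ (0# , 0#)
      head-0 = orthogonal⇒head-zero L₁ u₀↦e₀ v₀↦f₀
      u-head-0 : ∀ p → head (apply* L₁ (u (suc p))) ≈ₚ (0# , 0#)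
      u-head-0 p = head-0 (proj₁ (basis zero (suc p)))
        (trans (ω-antisym (v zero) (u (suc p))) (trans (-‿cong (proj₂ (proj₂ (basis (suc p) zero)))) -0#≈0#))
      v-head-0 : ∀ p → head (apply* L₁ (v (suc p))) ≈ₚ (0# , 0#)
      v-head-0 p = head-0 (proj₂ (proj₂ (basis zero (suc p)))) (proj₁ (proj₂ (basis zero (suc p))))
      tails-ω : ∀ {a} b → head (apply* L₁ a) ≈ₚ (0# , 0#) →
                ω (tail (apply* L₁ a)) (tail (apply* L₁ b)) ≈ ω a b
      tails-ω {a} b head≈0 = trans (sym (ω-tail (apply* L₁ a) (apply* L₁ b) head≈0)) (apply*-ω L₁ a b)
      u′ v′ : Fin k → Hyp k
      u′ p = tail (apply* L₁ (u (suc p)))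
      v′ p = tail (apply* L₁ (v (suc p)))
      basis′ : IsSymplecticBasis u′ v′
      basis′ p q = let uu , vv , uv = basis (suc p) (suc q) in
        trans (tails-ω (u (suc q)) (u-head-0 p)) uu ,
        trans (tails-ω (v (suc q)) (v-head-0 p)) vv ,
        trans (tails-ω (v (suc q)) (u-head-0 p)) (trans uv (reflexive (δ-suc p q)))
      rest = reduce-basis usc u′ v′ basis′
      L₂ = proj₁ rest
      reduced : ∀ p → apply* (L₁ ++ map lift L₂) (u p) ≋ e p × apply* (L₁ ++ map lift L₂) (v p) ≋ f p
      reduced zero    = apply*-extend L₁ L₂ (u₀↦e₀ zero) (≋-trans (apply*-cong L₂ (u₀↦e₀ ∘ suc)) (apply*-zero L₂))
                      , apply*-extend L₁ L₂ (v₀↦f₀ zero) (≋-trans (apply*-cong L₂ (v₀↦f₀ ∘ suc)) (apply*-zero L₂))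
      reduced (suc p) = apply*-extend L₁ L₂ (u-head-0 p) (≋-trans (proj₁ (proj₂ rest p)) (e-suc p))
                      , apply*-extend L₁ L₂ (v-head-0 p) (≋-trans (proj₂ (proj₂ rest p)) (f-suc p))

    J-contract-↑ˡ : ∀ {k} (a : Fin (k ℕ.+ k) → Carrier) q → sumF R (λ m → a m * J R k m (q ↑ˡ k)) ≈ - a (k ↑ʳ q)
    J-contract-↑ˡ {k} a q = begin
      sumF R (λ m → a m * J R k m (q ↑ˡ k))
        ≈⟨ sumF-split k k _ ⟩
      sumF R (λ p → a (p ↑ˡ k) * J R k (p ↑ˡ k) (q ↑ˡ k)) + sumF R (λ p → a (k ↑ʳ p) * J R k (k ↑ʳ p) (q ↑ˡ k))
        ≈⟨ +-cong (sumF-zero λ p → trans (*-congˡ (reflexive (J-↑ˡ-↑ˡ k p q))) (zeroʳ _))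
                  (sumF-cong λ p → trans (*-congˡ (reflexive (J-↑ʳ-↑ˡ k p q))) (sym (-‿distribʳ-* _ _))) ⟩
      0# + sumF R (λ p → - (a (k ↑ʳ p) * δ R p q))
        ≈⟨ trans (+-identityˡ _) (trans (sumF-neg {k} _) (-‿cong (sumF-δ (a ∘ (k ↑ʳ_)) q))) ⟩
      - a (k ↑ʳ q) ∎

    J-contract-↑ʳ : ∀ {k} (a : Fin (k ℕ.+ k) → Carrier) q → sumF R (λ m → a m * J R k m (k ↑ʳ q)) ≈ a (q ↑ˡ k)
    J-contract-↑ʳ {k} a q = begin
      sumF R (λ m → a m * J R k m (k ↑ʳ q))
        ≈⟨ sumF-split k k _ ⟩
      sumF R (λ p → a (p ↑ˡ k) * J R k (p ↑ˡ k) (k ↑ʳ q)) + sumF R (λ p → a (k ↑ʳ p) * J R k (k ↑ʳ p) (k ↑ʳ q))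
        ≈⟨ +-cong (sumF-cong λ p → *-congˡ (reflexive (J-↑ˡ-↑ʳ k p q)))
                  (sumF-zero λ p → trans (*-congˡ (reflexive (J-↑ʳ-↑ʳ k p q))) (zeroʳ _)) ⟩
      sumF R (λ p → a (p ↑ˡ k) * δ R p q) + 0#
        ≈⟨ trans (+-identityʳ _) (sumF-δ (a ∘ (_↑ˡ k)) q) ⟩
      a (q ↑ˡ k) ∎

    symplecticForm≈ω : ∀ {k} (M : Mat R (k ℕ.+ k)) i j →
                       _⊗_ R (_⊗_ R (_ᵗ R M) (J R k)) M i j ≈ ω (column {k} M i) (column M j)
    symplecticForm≈ω {k} M i j = begin
      sumF R (λ l → row l * M l j)
        ≈⟨ sumF-split k k _ ⟩
      sumF R (λ q → row (q ↑ˡ k) * M (q ↑ˡ k) j) + sumF R (λ q → row (k ↑ʳ q) * M (k ↑ʳ q) j)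
        ≈⟨ +-cong (sumF-cong λ q → *-congʳ (J-contract-↑ˡ {k} (λ m → M m i) q))
                  (sumF-cong λ q → *-congʳ (J-contract-↑ʳ {k} (λ m → M m i) q)) ⟩
      sumF R (λ q → - M (k ↑ʳ q) i * M (q ↑ˡ k) j) + sumF R (λ q → M (q ↑ˡ k) i * M (k ↑ʳ q) j)
        ≈⟨ sumF-+ {k} _ _ ⟨
      sumF R (λ q → - M (k ↑ʳ q) i * M (q ↑ˡ k) j + M (q ↑ˡ k) i * M (k ↑ʳ q) j)
        ≈⟨ sumF-cong (λ q → solve 4 (λ y x′ x y′ → :- y :* x′ :+ x :* y′ := x :* y′ :- y :* x′) refl
                                  (M (k ↑ʳ q) i) (M (q ↑ˡ k) j) (M (q ↑ˡ k) i) (M (k ↑ʳ q) j)) ⟩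
      ω (column {k} M i) (column M j) ∎
      where
      row : Fin (k ℕ.+ k) → Carrier
      row l = sumF R (λ m → M m i * J R k m l)

    ω-basis : ∀ {k} (i j : Fin (k ℕ.+ k)) → ω (basis {k} i) (basis j) ≈ J R k i j
    ω-basis {k} i j with splitAt k i | splitAt k j
    ... | inj₁ p | inj₁ q =
      sumF-zero λ r → solve 2 (λ a b → a :* con 0ℤ :- con 0ℤ :* b := con 0ℤ) refl (δ R r p) (δ R r q)
    ... | inj₁ p | inj₂ q =
      trans (sumF-cong λ r → solve 2 (λ a b → a :* b :- con 0ℤ :* con 0ℤ := b :* a) refl (δ R r p) (δ R r q))
            (sumF-δ (λ r → δ R r q) p)
    ... | inj₂ p | inj₁ q =
      trans (sumF-cong λ r → solve 2 (λ a b → con 0ℤ :* con 0ℤ :- a :* b := :- (b :* a)) refl (δ R r p) (δ R r q))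
            (trans (sumF-neg {k} _) (-‿cong (sumF-δ (λ r → δ R r q) p)))
    ... | inj₂ p | inj₂ q =
      sumF-zero λ r → solve 2 (λ a b → con 0ℤ :* b :- a :* con 0ℤ := con 0ℤ) refl (δ R r p) (δ R r q)

    entry-cong : ∀ {k} {u v : Hyp k} → u ≋ v → ∀ i → entry u i ≈ entry v i
    entry-cong {k} u≋v i with splitAt k i
    ... | inj₁ q = proj₁ (u≋v q)
    ... | inj₂ q = proj₂ (u≋v q)

    gram⇒symplecticBasis : ∀ {k} (b : Fin (k ℕ.+ k) → Hyp k) → (∀ i j → ω (b i) (b j) ≈ J R k i j) →
                           IsSymplecticBasis (b ∘ (_↑ˡ k)) (b ∘ (k ↑ʳ_))
    gram⇒symplecticBasis {k} b gram p q = trans (gram _ _) (reflexive (J-↑ˡ-↑ˡ k p q))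
                                        , trans (gram _ _) (reflexive (J-↑ʳ-↑ʳ k p q))
                                        , trans (gram _ _) (reflexive (J-↑ˡ-↑ʳ k p q))

    reduce-family : USC₃ → ∀ {k} (b : Fin (k ℕ.+ k) → Hyp k) → (∀ i j → ω (b i) (b j) ≈ J R k i j) →
                    ∃ λ L → ∀ j → apply* L (b j) ≋ basis j
    reduce-family usc {k} b gram with reduce-basis usc (b ∘ (_↑ˡ k)) (b ∘ (k ↑ʳ_)) (gram⇒symplecticBasis b gram)
    ... | L , reduced = L , to-basis
      where
      to-basis : ∀ j → apply* L (b j) ≋ basis j
      to-basis j with splitAt k j in eq
      ... | inj₁ p rewrite ≡.sym (splitAt⁻¹-↑ˡ eq) = proj₁ (reduced p)
      ... | inj₂ p rewrite ≡.sym (splitAt⁻¹-↑ʳ eq) = proj₂ (reduced p)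

module Quotient {c ℓ ℓI : Level} (R : CommutativeRing c ℓ) {I : CommutativeRing.Carrier R → Set ℓI}
                (ideal : IsIdeal R I) where
  open CommutativeRing R hiding (zero)
  open IsIdeal ideal
  open IntegerSolver R using (solve; _:=_; _:+_; _:*_; :-_; _:-_; con)

  infix 4 _≡ᵢ_
  _≡ᵢ_ : Rel Carrier ℓI
  x ≡ᵢ y = I (x - y)

  ≈⇒≡ᵢ : ∀ {x y} → x ≈ y → x ≡ᵢ y
  ≈⇒≡ᵢ {x} {y} x≈y = ∈-resp (sym (trans (+-congʳ x≈y) (-‿inverseʳ y))) 0∈

  ≡ᵢ-sym : ∀ {x y} → x ≡ᵢ y → y ≡ᵢ x
  ≡ᵢ-sym {x} {y} x≡y = ∈-resp (solve 2 (λ x y → :- con 1ℤ :* (x :- y) := y :- x) refl x y) (*∈ (- 1#) x≡y)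

  ≡ᵢ-trans : ∀ {x y z} → x ≡ᵢ y → y ≡ᵢ z → x ≡ᵢ z
  ≡ᵢ-trans {x} {y} {z} x≡y y≡z =
    ∈-resp (solve 3 (λ x y z → (x :- y) :+ (y :- z) := x :- z) refl x y z) (+∈ x≡y y≡z)

  +-cong-≡ᵢ : ∀ {x y u v} → x ≡ᵢ y → u ≡ᵢ v → x + u ≡ᵢ y + v
  +-cong-≡ᵢ {x} {y} {u} {v} x≡y u≡v =
    ∈-resp (solve 4 (λ x y u v → (x :- y) :+ (u :- v) := (x :+ u) :- (y :+ v)) refl x y u v) (+∈ x≡y u≡v)

  *-cong-≡ᵢ : ∀ {x y u v} → x ≡ᵢ y → u ≡ᵢ v → x * u ≡ᵢ y * v
  *-cong-≡ᵢ {x} {y} {u} {v} x≡y u≡v =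
    ∈-resp (solve 4 (λ x y u v → u :* (x :- y) :+ y :* (u :- v) := (x :* u) :- (y :* v)) refl x y u v)
           (+∈ (*∈ u x≡y) (*∈ y u≡v))

  -‿cong-≡ᵢ : ∀ {x y} → x ≡ᵢ y → - x ≡ᵢ - y
  -‿cong-≡ᵢ {x} {y} x≡y =
    ∈-resp (solve 2 (λ x y → :- con 1ℤ :* (x :- y) := (:- x) :- (:- y)) refl x y) (*∈ (- 1#) x≡y)

  ≡ᵢ-isCommutativeRing : IsCommutativeRing _≡ᵢ_ _+_ _*_ -_ 0# 1#
  ≡ᵢ-isCommutativeRing = record
    { isRing = record
      { +-isAbelianGroup = record
        { isGroup = record
          { isMonoid = record
            { isSemigroup = record
              { isMagma = record
                { isEquivalence = record { refl = ≈⇒≡ᵢ refl ; sym = ≡ᵢ-sym ; trans = ≡ᵢ-trans }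
                ; ∙-cong = +-cong-≡ᵢ }
              ; assoc = λ x y z → ≈⇒≡ᵢ (+-assoc x y z) }
            ; identity = (λ x → ≈⇒≡ᵢ (+-identityˡ x)) , (λ x → ≈⇒≡ᵢ (+-identityʳ x)) }
          ; inverse = (λ x → ≈⇒≡ᵢ (-‿inverseˡ x)) , (λ x → ≈⇒≡ᵢ (-‿inverseʳ x))
          ; ⁻¹-cong = -‿cong-≡ᵢ }
        ; comm = λ x y → ≈⇒≡ᵢ (+-comm x y) }
      ; *-cong = *-cong-≡ᵢ
      ; *-assoc = λ x y z → ≈⇒≡ᵢ (*-assoc x y z)
      ; *-identity = (λ x → ≈⇒≡ᵢ (*-identityˡ x)) , (λ x → ≈⇒≡ᵢ (*-identityʳ x))
      ; distrib = (λ x y z → ≈⇒≡ᵢ (distribˡ x y z)) , (λ x y z → ≈⇒≡ᵢ (distribʳ x y z)) }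
    ; *-comm = λ x y → ≈⇒≡ᵢ (*-comm x y) }

  open Hyperbolic R
  module Exact = Laws isCommutativeRing
  module Mod = Laws ≡ᵢ-isCommutativeRing

  -- Apply the USC to the unital set {x, y, s, z} with z = 1 - (x α + y β + s γ) ∈ I;
  -- the multiple of z it adds vanishes modulo I.
  usc⇒USC₃ : USC R I → Mod.USC₃
  usc⇒USC₃ usc x y s α β γ unital =
    let b , (d , b≈) , v , unit = usc 2 (x ∷ y ∷ s ∷ z ∷ []) (α ∷ β ∷ γ ∷ 1# ∷ [] , expansion)
    in d zero , d (suc zero) , v , ≡ᵢ-trans (*-cong-≡ᵢ (shift d b b≈) (≈⇒≡ᵢ refl)) unit
    where
    z = 1# - (x * α + y * β + s * γ)
    z∈I : I z
    z∈I = ∈-resp (solve 3 (λ a b c → :- con 1ℤ :* (a :+ b :+ c :- con 1ℤ) := con 1ℤ :- (a :+ b :+ c)) refl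
                           (x * α) (y * β) (s * γ))
                 (*∈ (- 1#) unital)
    expansion : 1# ≈ α * x + (β * y + (γ * s + (1# * z + 0#)))
    expansion = solve 6 (λ x y s α β γ → con 1ℤ := α :* x :+ (β :* y :+ (γ :* s :+
                                           (con 1ℤ :* (con 1ℤ :- (x :* α :+ y :* β :+ s :* γ)) :+ con 0ℤ))))
                  refl x y s α β γ
    shift : ∀ (d : Fin 3 → Carrier) b → b ≈ d zero * y + (d (suc zero) * s + (d (suc (suc zero)) * z + 0#)) →
            x + d zero * y + d (suc zero) * s ≡ᵢ x + b
    shift d b b≈ =
      ∈-resp (trans (solve 7 (λ x y s r r′ r″ z → :- r″ :* z := (x :+ r :* y :+ r′ :* s)
                                                                :- (x :+ (r :* y :+ (r′ :* s :+ (r″ :* z :+ con 0ℤ)))))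
                             refl x y s (d zero) (d (suc zero)) (d (suc (suc zero))) z)
                    (+-congˡ (-‿cong (+-congˡ (sym b≈)))))
             (*∈ (- d (suc (suc zero))) z∈I)

  -- The columns of A are the inverse steps applied to the standard basis: computed in R they keep
  -- ω exact, while modulo I they return the columns of B.
  lift-symplectic : ∀ {k} (L : List (Step k)) (B : Mat R (k ℕ.+ k)) →
                    (∀ j → apply* L (column {k} B j) Mod.≋ basis j) →
                    ∃ λ A → IsSymplectic R k A × (∀ i j → A i j ≡ᵢ B i j)
  lift-symplectic {k} L B reduces = A , symplectic , A≡B
    where
    A : Mat R (k ℕ.+ k)
    A i j = entry (apply* (inverse* L) (basis j)) i
    column-A : ∀ j → column {k} A j Exact.≋ apply* (inverse* L) (basis j)
    column-A j q = reflexive (≡.cong proj₁ entries) , reflexive (≡.cong proj₂ entries)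
      where entries = column-entry (apply* (inverse* L) (basis j)) q
    symplectic : IsSymplectic R k A
    symplectic i j = begin
      _                                                                 ≈⟨ Exact.symplecticForm≈ω {k} A i j ⟩
      ω (column {k} A i) (column A j)                                   ≈⟨ Exact.ω-cong (column-A i) (column-A j) ⟩
      ω (apply* (inverse* L) (basis i)) (apply* (inverse* L) (basis j)) ≈⟨ Exact.apply*-ω (inverse* L) _ _ ⟩
      ω (basis {k} i) (basis j)                                         ≈⟨ Exact.ω-basis {k} i j ⟩
      J R k i j                                                         ∎
      where open import Relation.Binary.Reasoning.Setoid setoid
    A≡B : ∀ i j → A i j ≡ᵢ B i j
    A≡B i j = ≡.subst (A i j ≡ᵢ_) (entry-column {k} B i j) (Mod.entry-cong columns≡ i)
      where
      columns≡ : apply* (inverse* L) (basis j) Mod.≋ column B j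
      columns≡ = Mod.≋-trans (Mod.apply*-cong (inverse* L) (Mod.≋-sym (reduces j))) (Mod.apply*-inverse L (column B j))

mainTheorem2 : ∀ {c ℓ ℓI : Level} (R : CommutativeRing c ℓ) (k : ℕ)
                 (I : CommutativeRing.Carrier R → Set ℓI) →
                 IsIdeal R I → IsProper R I → USC R I →
                 ReductionSurjective R I k
mainTheorem2 R k I ideal _ usc B B-symplectic =
  let L , reduces = Mod.reduce-family (usc⇒USC₃ usc) (column {k} B) gram
  in  lift-symplectic L B reduces
  where
  open Quotient R ideal
  open Hyperbolic R using (column; ω)
  gram : ∀ i j → ω (column {k} B i) (column B j) ≡ᵢ J R k i j
  gram i j = ≡ᵢ-trans (≡ᵢ-sym (Mod.symplecticForm≈ω {k} B i j)) (B-symplectic i j)
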